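{- For every finite lattice $L$ there exists a finite arc-colored digraph $D$ such that $\mathrm{End}(D)\cong(L,\wedge)$ and $\Delta^{\pm}(D)\leq 2$.
   Context: A digraph with $K$-colored arcs is $D=(V,\{A_c\mid c\in K\})$ with $A_c\subseteq V^2$ (loops allowed). $\mathrm{End}(D)$ is the monoid under composition of maps $\varphi:V\to V$ with $(u,v)\in A_c\Rightarrow(\varphi(u),\varphi(v))\in A_c$ for all $c$. $\Delta^{\pm}(D)$ is the maximum, over all colors $c$ and vertices $v$, of the out-degree and the in-degree of $v$ in $A_c$. A lattice is regarded as the monoid $(L,\wedge)$. -}

module Defs where

open import Data.Nat using (ℕ; _≤_; _+_)
open import Data.Fin using (Fin)
open import Data.Bool using (Bool; true; if_then_else_)
open import Data.List using (List; map; allFin)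
open import Data.Nat.ListAction using (sum)
open import Data.Product using (Σ; _×_; _,_)
open import Relation.Binary.PropositionalEquality using (_≡_)
open import Algebra.Lattice.Structures using (IsLattice)

-- A finite lattice, presented (up to isomorphism) on the carrier Fin (suc n)
-- with propositional equality, as an algebraic lattice (L, ∨, ∧).
-- The carrier is nonempty, as it must be for (L, ∧) to be a monoid.
record FinLattice (n : ℕ) : Set where
  field
    _∨_ : Fin n → Fin n → Fin n
    _∧_ : Fin n → Fin n → Fin n
    isLattice : IsLattice _≡_ _∨_ _∧_

-- A finite digraph with K-colored arcs: vertex set Fin m, color set Fin k,
-- A c u v = true  iff  (u , v) ∈ A_c  (loops allowed).
record ColDigraph : Set where
  field
    m : ℕ
    k : ℕ
    A : Fin k → Fin m → Fin m → Bool

module _ (D : ColDigraph) where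
  open ColDigraph D

  IsEndo : (Fin m → Fin m) → Set
  IsEndo φ = ∀ (c : Fin k) (u v : Fin m) → A c u v ≡ true → A c (φ u) (φ v) ≡ true

  End : Set
  End = Σ (Fin m → Fin m) IsEndo

  indicator : Bool → ℕ
  indicator b = if b then 1 else 0

  outdeg : Fin k → Fin m → ℕ
  outdeg c v = sum (map (λ u → indicator (A c v u)) (allFin m))

  indeg : Fin k → Fin m → ℕ
  indeg c v = sum (map (λ u → indicator (A c u v)) (allFin m))

  _∘ᴱ_ : End → End → End
  (φ , pφ) ∘ᴱ (ψ , pψ) = (λ x → φ (ψ x)) , (λ c u v e → pφ c (ψ u) (ψ v) (pψ c u v e))

  MaxDegreeAtMost : ℕ → Set
  MaxDegreeAtMost d = ∀ (c : Fin k) (v : Fin m) → (outdeg c v ≤ d) × (indeg c v ≤ d)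

_≗ᶠ_ : ∀ {m : ℕ} → (Fin m → Fin m) → (Fin m → Fin m) → Set
f ≗ᶠ g = ∀ x → f x ≡ g x

-- Monoid isomorphism End(D) ≅ (L, ∧): a bijection (up to equality of the
-- underlying maps) turning composition into meet.
-- (A bijective multiplicative map between monoids automatically preserves
-- the identity.)
record EndIsoMeet (D : ColDigraph) {n : ℕ} (L : FinLattice n) : Set where
  open FinLattice L
  field
    to   : End D → Fin n
    from : Fin n → End D
    to-cong : ∀ (φ ψ : End D) → Σ.proj₁ φ ≗ᶠ Σ.proj₁ ψ → to φ ≡ to ψ
    to-from : ∀ (x : Fin n) → to (from x) ≡ x
    from-to : ∀ (φ : End D) → Σ.proj₁ (from (to φ)) ≗ᶠ Σ.proj₁ φ
    hom : ∀ (φ ψ : End D) → to (_∘ᴱ_ D φ ψ) ≡ to φ ∧ to ψ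

module Submission where

-- Take the subsets of L as vertices. For each j ∈ L a colour sends every S to S ∖ {j}
-- (out-degree 1, in-degree 2: the preimages of S ∖ {j} are S ∖ {j} and S ∪ {j}); one more
-- colour puts a loop at every principal ideal ↓x. An endomorphism ψ commutes with all
-- deletions, and every S is obtained from L = ↓⊤ by deleting the elements outside S, so
-- ψ S = S ∩ ψ L; the loop at ↓⊤ forces ψ L = ↓b. Conversely S ↦ S ∩ ↓b is an
-- endomorphism because ↓x ∩ ↓b = ↓(x ∧ b), and these maps compose as meets in L.

open import Defs
open import Algebra.Lattice.Bundles using (Lattice)
open import Algebra.Lattice.Structures using (IsLattice)
import Algebra.Lattice.Properties.Lattice as LatticeProperties
import Relation.Binary.Lattice as OrderLattice
open import Data.Bool using (Bool; true; false; not; if_then_else_; _∧_; _∨_; T; T?)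
open import Data.Bool.Properties using (∧-identityʳ)
open import Data.Fin using (Fin; zero; suc; funToFin; finToFun; combine)
open import Data.Fin.Properties using (_≟_; any?; 2↔Bool; finToFun-funToFin; funToFin-finToFin)
open import Data.List using (List; []; _∷_; foldr; filter; map; tabulate; allFin)
open import Data.List.Properties using (map-tabulate)
open import Data.List.Membership.Propositional.Properties using (∈-filter⁺; ∈-filter⁻; ∈-allFin)
open import Data.Nat using (ℕ; zero; suc; _+_; _≤_; _^_; z≤n; s≤s)
open import Data.Nat.ListAction using (sum)
open import Data.Nat.Properties using (+-mono-≤; m≤n+m; +-commutativeSemigroup; module ≤-Reasoning)
open import Algebra.Properties.CommutativeSemigroup +-commutativeSemigroup using (interchange)
open import Data.Product using (Σ; _×_; _,_; proj₁; proj₂)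
open import Data.Sum using (_⊎_; inj₁; inj₂)
open import Data.Unit using (tt)
open import Function using (_∘_; Inverse; _⇔_; mk⇔)
open import Level using (0ℓ)
open import Relation.Binary.PropositionalEquality
open import Relation.Nullary using (Dec; yes; no; does; _×-dec_)
open import Relation.Nullary.Decidable using (dec-true; dec-false; does-⇔)

does-true⇒ : ∀ {a} {A : Set a} (a? : Dec A) → does a? ≡ true → A
does-true⇒ (yes a) _ = a

∧-true⇒ : ∀ {a b} → a ∧ b ≡ true → a ≡ true × b ≡ true
∧-true⇒ {true} {true} _ = refl , refl

≟-refl : ∀ {m} (u : Fin m) → does (u ≟ u) ≡ true
≟-refl u = dec-true (u ≟ u) refl

𝟙 : Bool → ℕ
𝟙 b = if b then 1 else 0

count : ∀ {m} → (Fin m → Bool) → ℕ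
count {m} f = sum (map (𝟙 ∘ f) (allFin m))

∑ : ∀ {m} → (Fin m → ℕ) → ℕ
∑ g = sum (tabulate g)

∑-mono-≤ : ∀ {m} {g h : Fin m → ℕ} → (∀ u → g u ≤ h u) → ∑ g ≤ ∑ h
∑-mono-≤ {zero}  g≤h = z≤n
∑-mono-≤ {suc m} g≤h = +-mono-≤ (g≤h zero) (∑-mono-≤ (g≤h ∘ suc))

∑-distrib-+ : ∀ {m} (g h : Fin m → ℕ) → ∑ (λ u → g u + h u) ≡ ∑ g + ∑ h
∑-distrib-+ {zero}  g h = refl
∑-distrib-+ {suc m} g h = trans (cong (g zero + h zero +_) (∑-distrib-+ (g ∘ suc) (h ∘ suc)))
  (interchange (g zero) (h zero) (∑ (g ∘ suc)) (∑ (h ∘ suc)))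

∑-zero : ∀ m → ∑ {m} (λ _ → 0) ≡ 0
∑-zero zero    = refl
∑-zero (suc m) = ∑-zero m

δ : ∀ {m} → Fin m → Fin m → ℕ
δ a u = 𝟙 (does (u ≟ a))

∑-δ : ∀ {m} (a : Fin m) → ∑ (δ a) ≡ 1
∑-δ {suc m} zero    = cong suc (∑-zero m)
∑-δ {suc m} (suc a) = ∑-δ a

count≤2 : ∀ {m} (f : Fin m → Bool) (a b : Fin m) →
          (∀ u → f u ≡ true → u ≡ a ⊎ u ≡ b) → count f ≤ 2
count≤2 {m} f a b f⊆ab = begin
  count f                                ≡⟨ cong sum (map-tabulate (λ u → u) (𝟙 ∘ f)) ⟩
  ∑ (𝟙 ∘ f)                              ≤⟨ ∑-mono-≤ pointwise ⟩
  ∑ (λ u → δ a u + δ b u)                ≡⟨ ∑-distrib-+ (δ a) (δ b) ⟩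
  ∑ (δ a) + ∑ (δ b)                      ≡⟨ cong₂ _+_ (∑-δ a) (∑-δ b) ⟩
  2                                      ∎
  where
  open ≤-Reasoning
  pointwise : ∀ u → 𝟙 (f u) ≤ δ a u + δ b u
  pointwise u with f u in fu
  ... | false = z≤n
  ... | true with f⊆ab u fu
  ...   | inj₁ refl rewrite ≟-refl u = s≤s z≤n
  ...   | inj₂ refl rewrite ≟-refl u = m≤n+m 1 (δ a u)

funToFin-cong : ∀ {m k} {f g : Fin m → Fin k} → (∀ i → f i ≡ g i) → funToFin f ≡ funToFin g
funToFin-cong {zero}  f≗g = refl
funToFin-cong {suc m} f≗g = cong₂ combine (f≗g zero) (funToFin-cong (f≗g ∘ suc))

module Subsets (N : ℕ) where
  open import Data.List.Membership.DecPropositional (_≟_ {N}) using (_∈?_)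
  open Inverse 2↔Bool using (to; from; strictlyInverseˡ; strictlyInverseʳ)

  -- A subset of Fin N is coded by a number below 2 ^ N, its characteristic function read in
  -- base 2; ⟦ u ⟧ decodes u back to that characteristic function.
  Subset : Set
  Subset = Fin (2 ^ N)

  decode : Subset → Fin N → Fin 2
  decode = finToFun

  ⟦_⟧ : Subset → Fin N → Bool
  ⟦ u ⟧ = to ∘ decode u

  encode : (Fin N → Bool) → Subset
  encode S = funToFin (from ∘ S)

  ⟦encode⟧ : ∀ S i → ⟦ encode S ⟧ i ≡ S i
  ⟦encode⟧ S i = trans (cong to (finToFun-funToFin (from ∘ S) i)) (strictlyInverseˡ (S i))

  ⟦⟧-injective : ∀ {u v} → (∀ i → ⟦ u ⟧ i ≡ ⟦ v ⟧ i) → u ≡ v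
  ⟦⟧-injective {u} {v} u≗v = begin
    u                       ≡⟨ funToFin-finToFin {N} u ⟨
    funToFin (decode u)     ≡⟨ funToFin-cong same ⟩
    funToFin (decode v)     ≡⟨ funToFin-finToFin {N} v ⟩
    v                       ∎
    where
    open ≡-Reasoning
    same : ∀ i → decode u i ≡ decode v i
    same i = trans (sym (strictlyInverseʳ _)) (trans (cong from (u≗v i)) (strictlyInverseʳ _))

  full : Subset
  full = encode (λ _ → true)

  _∩_ : Subset → Subset → Subset
  u ∩ v = encode (λ i → ⟦ u ⟧ i ∧ ⟦ v ⟧ i)

  put : Fin N → Bool → Subset → Subset
  put j b u = encode (λ i → if does (i ≟ j) then b else ⟦ u ⟧ i)

  del : Fin N → Subset → Subset
  del j = put j false

  delAll : List (Fin N) → Subset → Subset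
  delAll js u = foldr del u js

  outside? : (u : Subset) (j : Fin N) → Dec (T (not (⟦ u ⟧ j)))
  outside? u j = T? (not (⟦ u ⟧ j))

  outside : Subset → List (Fin N)
  outside u = filter (outside? u) (allFin N)

  ⟦full⟧ : ∀ i → ⟦ full ⟧ i ≡ true
  ⟦full⟧ = ⟦encode⟧ _

  ⟦∩⟧ : ∀ u v i → ⟦ u ∩ v ⟧ i ≡ ⟦ u ⟧ i ∧ ⟦ v ⟧ i
  ⟦∩⟧ u v = ⟦encode⟧ _

  ⟦put⟧ : ∀ j b u i → ⟦ put j b u ⟧ i ≡ (if does (i ≟ j) then b else ⟦ u ⟧ i)
  ⟦put⟧ j b u = ⟦encode⟧ _

  ∩-identityˡ : ∀ u → full ∩ u ≡ u
  ∩-identityˡ u = ⟦⟧-injective λ i → trans (⟦∩⟧ full u i) (cong (_∧ ⟦ u ⟧ i) (⟦full⟧ i))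

  ∩-identityʳ : ∀ u → u ∩ full ≡ u
  ∩-identityʳ u = ⟦⟧-injective λ i →
    trans (⟦∩⟧ u full i) (trans (cong (⟦ u ⟧ i ∧_) (⟦full⟧ i)) (∧-identityʳ (⟦ u ⟧ i)))

  ∩-del : ∀ j u v → del j u ∩ v ≡ del j (u ∩ v)
  ∩-del j u v = ⟦⟧-injective λ i → begin
    ⟦ del j u ∩ v ⟧ i                                      ≡⟨ ⟦∩⟧ (del j u) v i ⟩
    ⟦ del j u ⟧ i ∧ ⟦ v ⟧ i                                ≡⟨ cong (_∧ ⟦ v ⟧ i) (⟦put⟧ j false u i) ⟩
    (if does (i ≟ j) then false else ⟦ u ⟧ i) ∧ ⟦ v ⟧ i    ≡⟨ if-∧ (does (i ≟ j)) ⟩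
    (if does (i ≟ j) then false else ⟦ u ∩ v ⟧ i)          ≡⟨ ⟦put⟧ j false (u ∩ v) i ⟨
    ⟦ del j (u ∩ v) ⟧ i                                    ∎
    where
    open ≡-Reasoning
    if-∧ : ∀ {i} b → (if b then false else ⟦ u ⟧ i) ∧ ⟦ v ⟧ i ≡ (if b then false else ⟦ u ∩ v ⟧ i)
    if-∧ {i} false = sym (⟦∩⟧ u v i)
    if-∧     true  = refl

  ⟦delAll⟧ : ∀ js w i → ⟦ delAll js w ⟧ i ≡ (if does (i ∈? js) then false else ⟦ w ⟧ i)
  ⟦delAll⟧ []       w i = refl
  ⟦delAll⟧ (j ∷ js) w i = trans (⟦put⟧ j false (delAll js w) i) (if-∨ (does (i ≟ j)))
    where
    -- does (i ∈? j ∷ js) computes to does (i ≟ j) ∨ does (i ∈? js).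
    if-∨ : ∀ b → (if b then false else ⟦ delAll js w ⟧ i) ≡ (if b ∨ does (i ∈? js) then false else ⟦ w ⟧ i)
    if-∨ false = ⟦delAll⟧ js w i
    if-∨ true  = refl

  does-∈-outside : ∀ u i → does (i ∈? outside u) ≡ not (⟦ u ⟧ i)
  does-∈-outside u i with ⟦ u ⟧ i in u∋i
  ... | false = dec-true (i ∈? outside u)
                  (∈-filter⁺ (outside? u) (∈-allFin i) (subst (T ∘ not) (sym u∋i) tt))
  ... | true  = dec-false (i ∈? outside u)
                  (λ i∈ → subst (T ∘ not) u∋i (proj₂ (∈-filter⁻ (outside? u) {xs = allFin N} i∈)))

  delAll-outside : ∀ u w → delAll (outside u) w ≡ u ∩ w
  delAll-outside u w = ⟦⟧-injective λ i → begin
    ⟦ delAll (outside u) w ⟧ i                             ≡⟨ ⟦delAll⟧ (outside u) w i ⟩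
    (if does (i ∈? outside u) then false else ⟦ w ⟧ i)     ≡⟨ cong (λ b → if b then false else ⟦ w ⟧ i) (does-∈-outside u i) ⟩
    (if not (⟦ u ⟧ i) then false else ⟦ w ⟧ i)             ≡⟨ if-not (⟦ u ⟧ i) ⟩
    ⟦ u ⟧ i ∧ ⟦ w ⟧ i                                      ≡⟨ ⟦∩⟧ u w i ⟨
    ⟦ u ∩ w ⟧ i                                            ∎
    where
    open ≡-Reasoning
    if-not : ∀ {x} b → (if not b then false else x) ≡ b ∧ x
    if-not false = refl
    if-not true  = refl

  module _ {ψ : Subset → Subset} (ψ-del : ∀ j u → ψ (del j u) ≡ del j (ψ u)) where

    delAll-commute : ∀ js u → ψ (delAll js u) ≡ delAll js (ψ u)
    delAll-commute []       u = refl
    delAll-commute (j ∷ js) u = trans (ψ-del j _) (cong (del j) (delAll-commute js u))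

    del-commuting⇒∩ : ∀ u → ψ u ≡ u ∩ ψ full
    del-commuting⇒∩ u = begin
      ψ u                              ≡⟨ cong ψ (trans (delAll-outside u full) (∩-identityʳ u)) ⟨
      ψ (delAll (outside u) full)      ≡⟨ delAll-commute (outside u) full ⟩
      delAll (outside u) (ψ full)      ≡⟨ delAll-outside u (ψ full) ⟩
      u ∩ ψ full                       ∎
      where open ≡-Reasoning

  del-preimage : ∀ j u v → del j u ≡ v → u ≡ put j (⟦ u ⟧ j) v
  del-preimage j u v refl = ⟦⟧-injective λ i → sym (trans (⟦put⟧ j (⟦ u ⟧ j) (del j u) i) (agree (i ≟ j)))
    where
    agree : ∀ {i} → Dec (i ≡ j) → (if does (i ≟ j) then ⟦ u ⟧ j else ⟦ del j u ⟧ i) ≡ ⟦ u ⟧ i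
    agree {i} (yes refl) rewrite ≟-refl i = refl
    agree {i} (no i≢j) rewrite dec-false (i ≟ j) i≢j =
      trans (⟦put⟧ j false u i) (cong (λ b → if b then false else ⟦ u ⟧ i) (dec-false (i ≟ j) i≢j))

module DownSets {n} (L : FinLattice (suc n)) where
  open FinLattice L using (isLattice) renaming (_∨_ to _⊔_; _∧_ to _⊓_)
  open Subsets (suc n)

  lattice : Lattice 0ℓ 0ℓ
  lattice = record { isLattice = isLattice }

  open OrderLattice.Lattice (LatticeProperties.∨-∧-orderTheoreticLattice lattice)
    using (antisym; x≤x∨y; y≤x∨y; x∧y≤x; x∧y≤y; ∧-greatest)
    renaming (_≤_ to _⊑_; refl to ⊑-refl; trans to ⊑-trans)

  El : Set
  El = Fin (suc n)

  infix 4 _⊑?_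
  _⊑?_ : (i x : El) → Dec (i ⊑ x)
  i ⊑? x = i ≟ i ⊓ x

  ⋁ : ∀ {m} → (Fin (suc m) → El) → El
  ⋁ {zero}  g = g zero
  ⋁ {suc m} g = g zero ⊔ ⋁ (g ∘ suc)

  ⊑-⋁ : ∀ {m} (g : Fin (suc m) → El) j → g j ⊑ ⋁ g
  ⊑-⋁ {zero}  g zero    = ⊑-refl
  ⊑-⋁ {suc m} g zero    = x≤x∨y _ _
  ⊑-⋁ {suc m} g (suc j) = ⊑-trans (⊑-⋁ (g ∘ suc) j) (y≤x∨y _ _)

  ⊤ : El
  ⊤ = ⋁ (λ x → x)

  ↓ : El → Subset
  ↓ x = encode (λ i → does (i ⊑? x))

  ⟦↓⟧ : ∀ x i → ⟦ ↓ x ⟧ i ≡ does (i ⊑? x)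
  ⟦↓⟧ x = ⟦encode⟧ _

  ↓∋ : ∀ {i x} → i ⊑ x → ⟦ ↓ x ⟧ i ≡ true
  ↓∋ {i} {x} i⊑x = trans (⟦↓⟧ x i) (dec-true (i ⊑? x) i⊑x)

  ∈↓ : ∀ {i x} → ⟦ ↓ x ⟧ i ≡ true → i ⊑ x
  ∈↓ {i} {x} i∈↓x = does-true⇒ (i ⊑? x) (trans (sym (⟦↓⟧ x i)) i∈↓x)

  ↓-injective : ∀ {x y} → ↓ x ≡ ↓ y → x ≡ y
  ↓-injective {x} {y} ↓x≡↓y = antisym
    (∈↓ (subst (λ u → ⟦ u ⟧ x ≡ true) ↓x≡↓y (↓∋ {x} ⊑-refl)))
    (∈↓ (subst (λ u → ⟦ u ⟧ y ≡ true) (sym ↓x≡↓y) (↓∋ {y} ⊑-refl)))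

  ↓⊤≡full : ↓ ⊤ ≡ full
  ↓⊤≡full = ⟦⟧-injective λ i → trans (↓∋ (⊑-⋁ (λ x → x) i)) (sym (⟦full⟧ i))

  ↓-∩ : ∀ x y → ↓ x ∩ ↓ y ≡ ↓ (x ⊓ y)
  ↓-∩ x y = ⟦⟧-injective λ i → begin
    ⟦ ↓ x ∩ ↓ y ⟧ i                         ≡⟨ ⟦∩⟧ (↓ x) (↓ y) i ⟩
    ⟦ ↓ x ⟧ i ∧ ⟦ ↓ y ⟧ i                   ≡⟨ cong₂ _∧_ (⟦↓⟧ x i) (⟦↓⟧ y i) ⟩
    does (i ⊑? x ×-dec i ⊑? y)              ≡⟨ does-⇔ glb (i ⊑? x ×-dec i ⊑? y) (i ⊑? x ⊓ y) ⟩
    does (i ⊑? x ⊓ y)                       ≡⟨ ⟦↓⟧ (x ⊓ y) i ⟨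
    ⟦ ↓ (x ⊓ y) ⟧ i                         ∎
    where
    open ≡-Reasoning
    glb : ∀ {i} → (i ⊑ x × i ⊑ y) ⇔ i ⊑ x ⊓ y
    glb = mk⇔ (λ (i⊑x , i⊑y) → ∧-greatest i⊑x i⊑y)
              (λ i⊑x⊓y → ⊑-trans i⊑x⊓y (x∧y≤x x y) , ⊑-trans i⊑x⊓y (x∧y≤y x y))

module Construction {n} (L : FinLattice (suc n)) where
  open FinLattice L using (isLattice) renaming (_∧_ to _⊓_)
  open IsLattice isLattice using (∧-comm)
  open DownSets L
  open Subsets (suc n)

  isDown? : (u : Subset) → Dec (Σ El λ x → u ≡ ↓ x)
  isDown? u = any? λ x → u ≟ ↓ x

  isDown : Subset → Bool
  isDown u = does (isDown? u)

  Arc : Fin (suc (suc n)) → Subset → Subset → Bool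
  Arc zero    u v = isDown u ∧ does (u ≟ v)
  Arc (suc j) u v = does (v ≟ del j u)

  D : ColDigraph
  D = record { m = 2 ^ suc n ; k = suc (suc n) ; A = Arc }

  loop⇒≡ : ∀ {u v} → Arc zero u v ≡ true → u ≡ v
  loop⇒≡ {u} uv = does-true⇒ (_ ≟ _) (proj₂ (∧-true⇒ {isDown u} uv))

  meetWith : El → Subset → Subset
  meetWith b u = u ∩ ↓ b

  meetWith-isEndo : ∀ b → IsEndo D (meetWith b)
  meetWith-isEndo b zero u v uv with does-true⇒ (isDown? u) (proj₁ (∧-true⇒ {isDown u} uv)) | loop⇒≡ {u} {v} uv
  ... | x , refl | refl = cong₂ _∧_ (dec-true (isDown? _) (x ⊓ b , ↓-∩ x b)) (≟-refl (meetWith b (↓ x)))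
  meetWith-isEndo b (suc j) u v uv with does-true⇒ (v ≟ del j u) uv
  ... | refl = dec-true (_ ≟ _) (∩-del j u (↓ b))

  module _ {ψ : Subset → Subset} (ψ-endo : IsEndo D ψ) where

    image-of-↓⊤ : Σ El λ b → ψ (↓ ⊤) ≡ ↓ b
    image-of-↓⊤ = does-true⇒ (isDown? _) (proj₁ (∧-true⇒ (ψ-endo zero (↓ ⊤) (↓ ⊤) loop)))
      where
      loop : Arc zero (↓ ⊤) (↓ ⊤) ≡ true
      loop = cong₂ _∧_ (dec-true (isDown? _) (⊤ , refl)) (≟-refl (↓ ⊤))

    ψ-del : ∀ j u → ψ (del j u) ≡ del j (ψ u)
    ψ-del j u = does-true⇒ (ψ (del j u) ≟ del j (ψ u)) (ψ-endo (suc j) u (del j u) (≟-refl (del j u)))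

    endo≗meetWith : ∀ {b} → ψ (↓ ⊤) ≡ ↓ b → ∀ u → ψ u ≡ meetWith b u
    endo≗meetWith ψ↓⊤ u =
      trans (del-commuting⇒∩ ψ-del u) (cong (u ∩_) (trans (cong ψ (sym ↓⊤≡full)) ψ↓⊤))

  label : End D → El
  label (ψ , ψ-endo) = proj₁ (image-of-↓⊤ ψ-endo)

  label-unique : ∀ (φ : End D) {b} → proj₁ φ (↓ ⊤) ≡ ↓ b → label φ ≡ b
  label-unique (ψ , ψ-endo) ψ↓⊤ = ↓-injective (trans (sym (proj₂ (image-of-↓⊤ ψ-endo))) ψ↓⊤)

  End≅L : EndIsoMeet D L
  End≅L = record
    { to      = label
    ; from    = λ b → meetWith b , meetWith-isEndo b
    ; to-cong = λ φ ψ φ≗ψ → sym (label-unique ψ (trans (sym (φ≗ψ (↓ ⊤))) (proj₂ (image-of-↓⊤ (proj₂ φ)))))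
    ; to-from = λ b → label-unique (meetWith b , meetWith-isEndo b)
                        (trans (cong (_∩ ↓ b) ↓⊤≡full) (∩-identityˡ (↓ b)))
    ; from-to = λ (ψ , ψ-endo) u → sym (endo≗meetWith ψ-endo (proj₂ (image-of-↓⊤ ψ-endo)) u)
    ; hom     = λ φ ψ → label-unique (_∘ᴱ_ D φ ψ) (composite φ ψ)
    }
    where
    composite : ∀ φ ψ → proj₁ φ (proj₁ ψ (↓ ⊤)) ≡ ↓ (label φ ⊓ label ψ)
    composite (φ , φ-endo) (ψ , ψ-endo) = begin
      φ (ψ (↓ ⊤))     ≡⟨ cong φ (proj₂ (image-of-↓⊤ ψ-endo)) ⟩
      φ (↓ c)         ≡⟨ endo≗meetWith φ-endo (proj₂ (image-of-↓⊤ φ-endo)) (↓ c) ⟩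
      ↓ c ∩ ↓ b       ≡⟨ ↓-∩ c b ⟩
      ↓ (c ⊓ b)       ≡⟨ cong ↓ (∧-comm c b) ⟩
      ↓ (b ⊓ c)       ∎
      where
      open ≡-Reasoning
      b c : El
      b = label (φ , φ-endo)
      c = label (ψ , ψ-endo)

  degree≤2 : MaxDegreeAtMost D 2
  degree≤2 zero v =
      count≤2 (Arc zero v) v v (λ u vu → inj₁ (sym (loop⇒≡ vu)))
    , count≤2 (λ u → Arc zero u v) v v (λ u uv → inj₁ (loop⇒≡ uv))
  degree≤2 (suc j) v =
      count≤2 (Arc (suc j) v) (del j v) (del j v) (λ u vu → inj₁ (does-true⇒ (u ≟ del j v) vu))
    , count≤2 (λ u → Arc (suc j) u v) (put j false v) (put j true v) preimage
    where
    preimage : ∀ u → Arc (suc j) u v ≡ true → u ≡ put j false v ⊎ u ≡ put j true v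
    preimage u uv = either (⟦ u ⟧ j) (del-preimage j u v (sym (does-true⇒ (v ≟ del j u) uv)))
      where
      either : ∀ b → u ≡ put j b v → u ≡ put j false v ⊎ u ≡ put j true v
      either false = inj₁
      either true  = inj₂

lemma12 : (n : ℕ) (L : FinLattice (suc n)) →
    Σ ColDigraph (λ D → EndIsoMeet D L × MaxDegreeAtMost D 2)
lemma12 n L = D , End≅L , degree≤2
  where open Construction L
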